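{- Let $M$ be a position with $\Sigma(M) = 2s+e$, where $s \in \mathbf{N}_0$ and $e \in \mathbf{N}$, and let $b \in \mathbf{N}$. Then \[ \delta^{(b)}_e(M) = \sum_{r=0}^{s} \binom{s+b-1-r}{b-1} (-1)^r \alpha_r(M). \]
   Context: A position is a finite multiset of non-negative integers, regarded as an indexed family $(m_i)_{i\in I}$; a subposition $N$ of $M$ is the subfamily indexed by a subset of $I$ (distinct index subsets count as distinct subpositions), $\bar N$ is its complement, and $\Sigma(N)$ is the sum of the elements of $N$. $\alpha_r(M)$ is the number of subpositions $N$ of $M$ with $\Sigma(N) = r$. Set $\epsilon_M(N) = \Sigma(\bar N) - \Sigma(N)$. For $e \in \mathbf{N}$ with $e \equiv \Sigma(M) \pmod 2$ define $\delta_e(M) = \sum_N (-1)^{\Sigma(N)}$, summed over subpositions $N$ of $M$ with $\epsilon_M(N) \ge e$. Define $\delta^{(1)}_e(M) = \delta_e(M)$ and, for $b \ge 2$, recursively $\delta^{(b)}_e(M) = \sum_{t \in \mathbf{N}_0} \delta^{(b-1)}_{e+2t}(M)$ (a finite sum, since terms with $e+2t > \Sigma(M)$ vanish). -}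

module Defs where

open import Data.Nat using (ℕ; zero; suc; _+_; _*_; _≤ᵇ_; _≡ᵇ_)
open import Data.Nat.Combinatorics using (_C_)
open import Data.Bool using (Bool; true; false; if_then_else_)
open import Data.Vec using (Vec; []; _∷_)
open import Data.List using (List; []; _∷_; map; _++_; upTo)
import Data.Integer as ℤ
open ℤ using (ℤ)

Position : ℕ → Set
Position n = Vec ℕ n

-- A subposition is given by its index subset, a Vec Bool n (true = index chosen).
Sub : ℕ → Set
Sub n = Vec Bool n

subsets : (n : ℕ) → List (Sub n)
subsets zero    = [] ∷ []
subsets (suc n) = map (false ∷_) (subsets n) ++ map (true ∷_) (subsets n)

Σ : ∀ {n} → Position n → ℕ
Σ []       = 0
Σ (m ∷ ms) = m + Σ ms

ΣSub : ∀ {n} → Position n → Sub n → ℕ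
ΣSub []       []       = 0
ΣSub (m ∷ ms) (true  ∷ s) = m + ΣSub ms s
ΣSub (m ∷ ms) (false ∷ s) = ΣSub ms s

ΣCo : ∀ {n} → Position n → Sub n → ℕ
ΣCo []       []       = 0
ΣCo (m ∷ ms) (true  ∷ s) = ΣCo ms s
ΣCo (m ∷ ms) (false ∷ s) = m + ΣCo ms s

ε : ∀ {n} → Position n → Sub n → ℤ
ε M S = ℤ.+ (ΣCo M S) ℤ.- ℤ.+ (ΣSub M S)

sumℤ : List ℤ → ℤ
sumℤ []       = ℤ.0ℤ
sumℤ (x ∷ xs) = x ℤ.+ sumℤ xs

sumℕ : List ℕ → ℕ
sumℕ []       = 0
sumℕ (x ∷ xs) = x + sumℕ xs

sign : ℕ → ℤ
sign zero          = ℤ.1ℤ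
sign (suc zero)    = ℤ.-1ℤ
sign (suc (suc k)) = sign k

α : ∀ {n} → ℕ → Position n → ℕ
α r M = sumℕ (map (λ S → if ΣSub M S ≡ᵇ r then 1 else 0) (subsets _))

geqℤ : ℤ → ℕ → Bool
geqℤ (ℤ.+ k)    e = e ≤ᵇ k
geqℤ ℤ.-[1+ k ] e = false

δ : ∀ {n} → ℕ → Position n → ℤ
δ e M = sumℤ (map (λ S → if geqℤ (ε M S) e then sign (ΣSub M S) else ℤ.0ℤ) (subsets _))

-- δ^{(b+1)}_e(M) ; δ^{(1)} = δ, δ^{(b+1)}_e = Σ_{t ≥ 0} δ^{(b)}_{e+2t}.
-- The sum over t is truncated at t < Σ(M)+1; all omitted terms have
-- e + 2t > Σ(M) and hence vanish.
δ⁽_⁾ : ∀ {n} → ℕ → ℕ → Position n → ℤ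
δ⁽ zero  ⁾ e M = δ e M
δ⁽ suc b ⁾ e M = sumℤ (map (λ t → δ⁽ b ⁾ (e + 2 * t) M) (upTo (suc (Σ M))))

-- δ^{(b)} for b ≥ 1 (paper indexing)
deltaB : ∀ {n} → (b : ℕ) → ℕ → Position n → ℤ
deltaB zero    e M = δ e M   -- not used (b ∈ ℕ means b ≥ 1)
deltaB (suc b) e M = δ⁽ b ⁾ e M

-- Since Σ(N) + Σ(N̄) = 2s + e, the condition ε_M(N) ≥ e says exactly Σ(N) ≤ s, so
-- δ_e(M) = Σ_{r ≤ s} (-1)^r α_r(M); this is the case b = 1. Splitting off the t = 0
-- term gives δ^{(b+1)}_e = δ^{(b)}_e + δ^{(b+1)}_{e+2}, where passing from e to e + 2
-- lowers s by one, and the binomial weights satisfy the same recursion by Pascal's rule.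
module Submission where

open import Defs
open import Data.Nat using (ℕ; suc; _+_; _*_; _∸_)
open import Data.Nat.Combinatorics using (_C_)
open import Data.List using (map; upTo)
open import Relation.Binary.PropositionalEquality using (_≡_)
import Data.Integer as ℤ

open import Data.Bool using (true; false; if_then_else_)
open import Data.List using (List; []; _∷_; applyUpTo)
open import Data.Nat using (zero; _≤_; _<_; _≤ᵇ_; _<ᵇ_; _≡ᵇ_; z≤n; s≤s; s≤s⁻¹; z<s)
open import Data.Nat.Combinatorics using (nCn≡1; nCk+nC[k+1]≡[n+1]C[k+1])
open import Data.Nat.Properties
open import Data.Vec using ([]; _∷_)
open import Function using (_∘_; _⇔_; mk⇔; Equivalence)
open import Relation.Binary.PropositionalEquality
  using (refl; sym; trans; cong; cong₂; subst; module ≡-Reasoning)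
open import Relation.Nullary using (¬_)
open import Relation.Nullary.Reflects using (ofⁿ; fromEquivalence; det)
open ℤ using (ℤ; 0ℤ; _⊖_)
import Data.Integer.Properties as ℤP
import Data.Nat.Tactic.RingSolver as ℕSolver
open import Algebra.Properties.CommutativeSemigroup ℤP.+-commutativeSemigroup
  using (interchange; xy∙z≈xz∙y)

sumBelow : ℕ → (ℕ → ℤ) → ℤ
sumBelow zero    h = 0ℤ
sumBelow (suc n) h = h 0 ℤ.+ sumBelow n (h ∘ suc)

sumℤ-map-applyUpTo : ∀ (g : ℕ → ℤ) f n → sumℤ (map g (applyUpTo f n)) ≡ sumBelow n (g ∘ f)
sumℤ-map-applyUpTo g f zero    = refl
sumℤ-map-applyUpTo g f (suc n) = cong (ℤ._+_ (g (f 0))) (sumℤ-map-applyUpTo g (f ∘ suc) n)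

sumℤ-map-upTo : ∀ (g : ℕ → ℤ) n → sumℤ (map g (upTo n)) ≡ sumBelow n g
sumℤ-map-upTo g = sumℤ-map-applyUpTo g (λ r → r)

sumBelow-cong : ∀ n {h k : ℕ → ℤ} → (∀ {r} → r < n → h r ≡ k r) → sumBelow n h ≡ sumBelow n k
sumBelow-cong zero    h≡k = refl
sumBelow-cong (suc n) h≡k = cong₂ ℤ._+_ (h≡k (s≤s z≤n)) (sumBelow-cong n (h≡k ∘ s≤s))

sumBelow-0 : ∀ n → sumBelow n (λ _ → 0ℤ) ≡ 0ℤ
sumBelow-0 zero    = refl
sumBelow-0 (suc n) = trans (ℤP.+-identityˡ _) (sumBelow-0 n)

sumBelow-+ : ∀ n (h k : ℕ → ℤ) →
  sumBelow n (λ r → h r ℤ.+ k r) ≡ sumBelow n h ℤ.+ sumBelow n k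
sumBelow-+ zero    h k = refl
sumBelow-+ (suc n) h k = begin
  (h 0 ℤ.+ k 0) ℤ.+ sumBelow n (λ r → h (suc r) ℤ.+ k (suc r))
    ≡⟨ cong (ℤ._+_ (h 0 ℤ.+ k 0)) (sumBelow-+ n (h ∘ suc) (k ∘ suc)) ⟩
  (h 0 ℤ.+ k 0) ℤ.+ (sumBelow n (h ∘ suc) ℤ.+ sumBelow n (k ∘ suc))
    ≡⟨ interchange (h 0) (k 0) _ _ ⟩
  (h 0 ℤ.+ sumBelow n (h ∘ suc)) ℤ.+ (k 0 ℤ.+ sumBelow n (k ∘ suc)) ∎
  where open ≡-Reasoning

sumBelow-suc : ∀ n (h : ℕ → ℤ) → sumBelow (suc n) h ≡ sumBelow n h ℤ.+ h n
sumBelow-suc zero    h = trans (ℤP.+-identityʳ (h 0)) (sym (ℤP.+-identityˡ (h 0)))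
sumBelow-suc (suc n) h = trans (cong (ℤ._+_ (h 0)) (sumBelow-suc n (h ∘ suc)))
                               (sym (ℤP.+-assoc (h 0) _ _))

sumBelow-indicator : ∀ c n (h : ℕ → ℤ) →
  sumBelow n (λ r → h r ℤ.* ℤ.+ (if c ≡ᵇ r then 1 else 0)) ≡ (if c <ᵇ n then h c else 0ℤ)
sumBelow-indicator c       zero    h = refl
sumBelow-indicator zero    (suc n) h = begin
  h 0 ℤ.* ℤ.+ 1 ℤ.+ sumBelow n (λ r → h (suc r) ℤ.* 0ℤ)
    ≡⟨ cong₂ ℤ._+_ (ℤP.*-identityʳ (h 0)) (sumBelow-cong n (λ _ → ℤP.*-zeroʳ (h _))) ⟩
  h 0 ℤ.+ sumBelow n (λ _ → 0ℤ)
    ≡⟨ cong (ℤ._+_ (h 0)) (sumBelow-0 n) ⟩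
  h 0 ℤ.+ 0ℤ
    ≡⟨ ℤP.+-identityʳ (h 0) ⟩
  h 0 ∎
  where open ≡-Reasoning
sumBelow-indicator (suc c) (suc n) h =
  trans (cong₂ ℤ._+_ (ℤP.*-zeroʳ (h 0)) refl)
        (trans (ℤP.+-identityˡ _) (sumBelow-indicator c n (h ∘ suc)))

module _ {A : Set} where

  sumℤ-map-cong : ∀ {g k : A → ℤ} (xs : List A) → (∀ x → g x ≡ k x) →
    sumℤ (map g xs) ≡ sumℤ (map k xs)
  sumℤ-map-cong []       g≡k = refl
  sumℤ-map-cong (x ∷ xs) g≡k = cong₂ ℤ._+_ (g≡k x) (sumℤ-map-cong xs g≡k)

  sumℤ-map-0 : ∀ {g : A → ℤ} (xs : List A) → (∀ x → g x ≡ 0ℤ) → sumℤ (map g xs) ≡ 0ℤ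
  sumℤ-map-0 []       g≡0 = refl
  sumℤ-map-0 (x ∷ xs) g≡0 = cong₂ ℤ._+_ (g≡0 x) (sumℤ-map-0 xs g≡0)

  sumℤ-map-sumBelow : ∀ n (k : ℕ → A → ℤ) (xs : List A) →
    sumℤ (map (λ x → sumBelow n (λ r → k r x)) xs) ≡ sumBelow n (λ r → sumℤ (map (k r) xs))
  sumℤ-map-sumBelow n k []       = sym (sumBelow-0 n)
  sumℤ-map-sumBelow n k (x ∷ xs) =
    trans (cong (ℤ._+_ (sumBelow n (λ r → k r x))) (sumℤ-map-sumBelow n k xs))
          (sym (sumBelow-+ n (λ r → k r x) (λ r → sumℤ (map (k r) xs))))

  *-sumℕ-map : ∀ c (g : A → ℕ) (xs : List A) →
    c ℤ.* ℤ.+ sumℕ (map g xs) ≡ sumℤ (map (λ x → c ℤ.* ℤ.+ g x) xs)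
  *-sumℕ-map c g []       = ℤP.*-zeroʳ c
  *-sumℕ-map c g (x ∷ xs) = begin
    c ℤ.* ℤ.+ (g x + sumℕ (map g xs))
      ≡⟨ cong (c ℤ.*_) (ℤP.pos-+ (g x) _) ⟩
    c ℤ.* (ℤ.+ g x ℤ.+ ℤ.+ sumℕ (map g xs))
      ≡⟨ ℤP.*-distribˡ-+ c (ℤ.+ g x) _ ⟩
    c ℤ.* ℤ.+ g x ℤ.+ c ℤ.* ℤ.+ sumℕ (map g xs)
      ≡⟨ cong (ℤ._+_ (c ℤ.* ℤ.+ g x)) (*-sumℕ-map c g xs) ⟩
    sumℤ (map (λ x → c ℤ.* ℤ.+ g x) (x ∷ xs)) ∎
    where open ≡-Reasoning

-- binomialWeight b is the paper's weight C(s + b - 1 - r, b - 1) with b shifted by one,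
-- matching δ⁽ b ⁾ = δ^{(b+1)}.
binomialWeight : ℕ → ℕ → ℕ → ℕ
binomialWeight b s r = (s ∸ r + b) C b

weightedSum : ℕ → ℕ → (ℕ → ℤ) → ℤ
weightedSum b s f = sumBelow (suc s) (λ r → ℤ.+ binomialWeight b s r ℤ.* f r)

binomialWeight-diag : ∀ b s → binomialWeight b s s ≡ 1
binomialWeight-diag b s = trans (cong (λ x → (x + b) C b) (n∸n≡0 s)) (nCn≡1 b)

binomialWeight-pascal : ∀ b {s r} → r ≤ s →
  binomialWeight (suc b) (suc s) r ≡ binomialWeight b (suc s) r + binomialWeight (suc b) s r
binomialWeight-pascal b {s} {r} r≤s
  rewrite +-∸-assoc 1 r≤s | +-suc (s ∸ r) b = sym (nCk+nC[k+1]≡[n+1]C[k+1] (suc (s ∸ r + b)) b)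

weightedSum-zero : ∀ s (f : ℕ → ℤ) → weightedSum 0 s f ≡ sumBelow (suc s) f
weightedSum-zero s f = sumBelow-cong (suc s) (λ {r} _ → ℤP.*-identityˡ (f r))

weightedSum-at-0 : ∀ b (f : ℕ → ℤ) → weightedSum b 0 f ≡ f 0
weightedSum-at-0 b f = begin
  ℤ.+ ((0 + b) C b) ℤ.* f 0 ℤ.+ 0ℤ  ≡⟨ ℤP.+-identityʳ _ ⟩
  ℤ.+ (b C b) ℤ.* f 0               ≡⟨ cong (λ k → ℤ.+ k ℤ.* f 0) (nCn≡1 b) ⟩
  ℤ.+ 1 ℤ.* f 0                     ≡⟨ ℤP.*-identityˡ (f 0) ⟩
  f 0                                ∎
  where open ≡-Reasoning

weightedSum-pascal : ∀ b s (f : ℕ → ℤ) →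
  weightedSum (suc b) (suc s) f ≡ weightedSum b (suc s) f ℤ.+ weightedSum (suc b) s f
weightedSum-pascal b s f = begin
  sumBelow (suc (suc s)) (term (suc b) (suc s))
    ≡⟨ sumBelow-suc (suc s) (term (suc b) (suc s)) ⟩
  sumBelow (suc s) (term (suc b) (suc s)) ℤ.+ term (suc b) (suc s) (suc s)
    ≡⟨ cong₂ ℤ._+_ (sumBelow-cong (suc s) (term-pascal ∘ s≤s⁻¹)) last-term ⟩
  sumBelow (suc s) (λ r → term b (suc s) r ℤ.+ term (suc b) s r) ℤ.+ term b (suc s) (suc s)
    ≡⟨ cong (ℤ._+ term b (suc s) (suc s)) (sumBelow-+ (suc s) (term b (suc s)) (term (suc b) s)) ⟩
  (sumBelow (suc s) (term b (suc s)) ℤ.+ sumBelow (suc s) (term (suc b) s)) ℤ.+ term b (suc s) (suc s)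
    ≡⟨ xy∙z≈xz∙y (sumBelow (suc s) (term b (suc s))) _ _ ⟩
  (sumBelow (suc s) (term b (suc s)) ℤ.+ term b (suc s) (suc s)) ℤ.+ sumBelow (suc s) (term (suc b) s)
    ≡⟨ cong (ℤ._+ sumBelow (suc s) (term (suc b) s)) (sym (sumBelow-suc (suc s) (term b (suc s)))) ⟩
  weightedSum b (suc s) f ℤ.+ weightedSum (suc b) s f ∎
  where
  open ≡-Reasoning
  term : ℕ → ℕ → ℕ → ℤ
  term b s r = ℤ.+ binomialWeight b s r ℤ.* f r
  term-pascal : ∀ {r} → r ≤ s → term (suc b) (suc s) r ≡ term b (suc s) r ℤ.+ term (suc b) s r
  term-pascal {r} r≤s = begin
    ℤ.+ binomialWeight (suc b) (suc s) r ℤ.* f r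
      ≡⟨ cong (λ k → ℤ.+ k ℤ.* f r) (binomialWeight-pascal b r≤s) ⟩
    ℤ.+ (binomialWeight b (suc s) r + binomialWeight (suc b) s r) ℤ.* f r
      ≡⟨ cong (ℤ._* f r) (ℤP.pos-+ (binomialWeight b (suc s) r) _) ⟩
    (ℤ.+ binomialWeight b (suc s) r ℤ.+ ℤ.+ binomialWeight (suc b) s r) ℤ.* f r
      ≡⟨ ℤP.*-distribʳ-+ (f r) (ℤ.+ binomialWeight b (suc s) r) (ℤ.+ binomialWeight (suc b) s r) ⟩
    term b (suc s) r ℤ.+ term (suc b) s r ∎
  last-term : term (suc b) (suc s) (suc s) ≡ term b (suc s) (suc s)
  last-term = cong (λ k → ℤ.+ k ℤ.* f (suc s))
    (trans (binomialWeight-diag (suc b) (suc s)) (sym (binomialWeight-diag b (suc s))))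

c+e≤a⇔c≤s : ∀ {c a s e} → c + a ≡ 2 * s + e → (c + e ≤ a) ⇔ (c ≤ s)
c+e≤a⇔c≤s {c} {a} {s} {e} c+a≡2s+e = mk⇔ to from
  where
  open ≤-Reasoning
  double : 2 * c + e ≡ c + (c + e)
  double = trans (cong (λ x → c + x + e) (+-identityʳ c)) (+-assoc c c e)
  to : c + e ≤ a → c ≤ s
  to c+e≤a = *-cancelˡ-≤ 2 (+-cancelʳ-≤ e _ _ (begin
    2 * c + e   ≡⟨ double ⟩
    c + (c + e) ≤⟨ +-monoʳ-≤ c c+e≤a ⟩
    c + a       ≡⟨ c+a≡2s+e ⟩
    2 * s + e   ∎))
  from : c ≤ s → c + e ≤ a
  from c≤s = +-cancelˡ-≤ c _ _ (begin
    c + (c + e) ≡⟨ sym double ⟩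
    2 * c + e   ≤⟨ +-monoˡ-≤ e (*-monoʳ-≤ 2 c≤s) ⟩
    2 * s + e   ≡⟨ sym c+a≡2s+e ⟩
    c + a       ∎)

suc-≤ᵇ-suc : ∀ m n → (suc m ≤ᵇ suc n) ≡ (m ≤ᵇ n)
suc-≤ᵇ-suc zero    n = refl
suc-≤ᵇ-suc (suc m) n = refl

geqℤ-⊖ : ∀ a c e → geqℤ (a ⊖ c) e ≡ (c + e ≤ᵇ a)
geqℤ-⊖ a       zero    e = refl
geqℤ-⊖ zero    (suc c) e = refl
geqℤ-⊖ (suc a) (suc c) e = begin
  geqℤ (suc a ⊖ suc c) e  ≡⟨ cong (λ z → geqℤ z e) (ℤP.[1+m]⊖[1+n]≡m⊖n a c) ⟩
  geqℤ (a ⊖ c) e          ≡⟨ geqℤ-⊖ a c e ⟩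
  (c + e ≤ᵇ a)            ≡⟨ sym (suc-≤ᵇ-suc (c + e) a) ⟩
  (suc c + e ≤ᵇ suc a)    ∎
  where open ≡-Reasoning

ΣSub+ΣCo≡Σ : ∀ {n} (M : Position n) (S : Sub n) → ΣSub M S + ΣCo M S ≡ Σ M
ΣSub+ΣCo≡Σ []       []          = refl
ΣSub+ΣCo≡Σ (m ∷ M) (true  ∷ S) = trans (+-assoc m _ _) (cong (m +_) (ΣSub+ΣCo≡Σ M S))
ΣSub+ΣCo≡Σ (m ∷ M) (false ∷ S) = begin
  ΣSub M S + (m + ΣCo M S)  ≡⟨ +-swap (ΣSub M S) m (ΣCo M S) ⟩
  m + (ΣSub M S + ΣCo M S)  ≡⟨ cong (m +_) (ΣSub+ΣCo≡Σ M S) ⟩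
  m + Σ M                   ∎
  where
  open ≡-Reasoning
  +-swap : ∀ a b c → a + (b + c) ≡ b + (a + c)
  +-swap = ℕSolver.solve-∀

module _ {n} (M : Position n) where

  geqℤ-ε : ∀ S e → geqℤ (ε M S) e ≡ (ΣSub M S + e ≤ᵇ ΣCo M S)
  geqℤ-ε S e = trans (cong (λ z → geqℤ z e) (ℤP.[+m]-[+n]≡m⊖n (ΣCo M S) (ΣSub M S)))
                     (geqℤ-⊖ (ΣCo M S) (ΣSub M S) e)

  geqℤ-ε≡ΣSub≤ : ∀ S s e → Σ M ≡ 2 * s + e → geqℤ (ε M S) e ≡ (ΣSub M S <ᵇ suc s)
  geqℤ-ε≡ΣSub≤ S s e Σ≡2s+e = trans (geqℤ-ε S e) (det (≤ᵇ-reflects-≤ _ _)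
    (fromEquivalence (from ∘ s≤s⁻¹ ∘ <ᵇ⇒< _ _) (<⇒<ᵇ ∘ s≤s ∘ to)))
    where open Equivalence (c+e≤a⇔c≤s {ΣSub M S} {ΣCo M S} {s} {e} (trans (ΣSub+ΣCo≡Σ M S) Σ≡2s+e))

  geqℤ-ε≡false : ∀ S e → Σ M < e → geqℤ (ε M S) e ≡ false
  geqℤ-ε≡false S e Σ<e = trans (geqℤ-ε S e) (det (≤ᵇ-reflects-≤ _ _) (ofⁿ e≰ΣCo))
    where
    e≰ΣCo : ¬ ΣSub M S + e ≤ ΣCo M S
    e≰ΣCo le = <⇒≱ Σ<e (≤-trans (m≤n+m e _) (≤-trans le
      (subst (ΣCo M S ≤_) (ΣSub+ΣCo≡Σ M S) (m≤n+m _ _))))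

  signedα : ℕ → ℤ
  signedα r = sign r ℤ.* ℤ.+ α r M

  δ≡sumBelow-signedα : ∀ s e → Σ M ≡ 2 * s + e → δ e M ≡ sumBelow (suc s) signedα
  δ≡sumBelow-signedα s e Σ≡2s+e = sym (begin
    sumBelow (suc s) signedα
      ≡⟨ sumBelow-cong (suc s) (λ {r} _ → *-sumℕ-map (sign r) (indicator r) (subsets n)) ⟩
    sumBelow (suc s) (λ r → sumℤ (map (λ S → sign r ℤ.* ℤ.+ indicator r S) (subsets n)))
      ≡⟨ sym (sumℤ-map-sumBelow (suc s) (λ r S → sign r ℤ.* ℤ.+ indicator r S) (subsets n)) ⟩
    sumℤ (map (λ S → sumBelow (suc s) (λ r → sign r ℤ.* ℤ.+ indicator r S)) (subsets n))
      ≡⟨ sumℤ-map-cong (subsets n) (λ S → sumBelow-indicator (ΣSub M S) (suc s) sign) ⟩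
    sumℤ (map (λ S → if ΣSub M S <ᵇ suc s then sign (ΣSub M S) else 0ℤ) (subsets n))
      ≡⟨ sumℤ-map-cong (subsets n) (λ S → cong (λ t → if t then sign (ΣSub M S) else 0ℤ)
           (sym (geqℤ-ε≡ΣSub≤ S s e Σ≡2s+e))) ⟩
    δ e M ∎)
    where
    open ≡-Reasoning
    indicator : ℕ → Sub n → ℕ
    indicator r S = if ΣSub M S ≡ᵇ r then 1 else 0

  δ⁽⁾-vanishes : ∀ b e → Σ M < e → δ⁽ b ⁾ e M ≡ 0ℤ
  δ⁽⁾-vanishes zero    e Σ<e = sumℤ-map-0 (subsets n) (λ S →
    cong (λ t → if t then sign (ΣSub M S) else 0ℤ) (geqℤ-ε≡false S e Σ<e))
  δ⁽⁾-vanishes (suc b) e Σ<e = sumℤ-map-0 (upTo (suc (Σ M))) (λ t →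
    δ⁽⁾-vanishes b (e + 2 * t) (<-≤-trans Σ<e (m≤m+n e _)))

  δ⁽suc⁾-step : ∀ b e → δ⁽ suc b ⁾ e M ≡ δ⁽ b ⁾ e M ℤ.+ δ⁽ suc b ⁾ (e + 2) M
  δ⁽suc⁾-step b e = begin
    δ⁽ suc b ⁾ e M
      ≡⟨ sumℤ-map-upTo (λ t → δ⁽ b ⁾ (e + 2 * t) M) (suc N) ⟩
    δ⁽ b ⁾ (e + 2 * 0) M ℤ.+ sumBelow N (λ t → δ⁽ b ⁾ (e + 2 * suc t) M)
      ≡⟨ cong₂ ℤ._+_ (cong (λ x → δ⁽ b ⁾ x M) (+-identityʳ e))
                     (sumBelow-cong N (λ {t} _ → cong (λ x → δ⁽ b ⁾ x M) (e+2[1+t]≡e+2+2t e t))) ⟩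
    δ⁽ b ⁾ e M ℤ.+ sumBelow N tail
      ≡⟨ cong (ℤ._+_ (δ⁽ b ⁾ e M)) (sym δ⁽suc⁾[e+2]≡sumBelow-tail) ⟩
    δ⁽ b ⁾ e M ℤ.+ δ⁽ suc b ⁾ (e + 2) M ∎
    where
    open ≡-Reasoning
    N = Σ M
    tail : ℕ → ℤ
    tail t = δ⁽ b ⁾ (e + 2 + 2 * t) M
    e+2[1+t]≡e+2+2t : ∀ e t → e + 2 * suc t ≡ e + 2 + 2 * t
    e+2[1+t]≡e+2+2t = ℕSolver.solve-∀
    N<e+2+2N : N < e + 2 + 2 * N
    N<e+2+2N = <-≤-trans (m<n+m N {2} z<s) (+-mono-≤ (m≤n+m 2 e) (m≤n*m N 2))
    -- δ⁽ suc b ⁾ sums only over t ≤ Σ M, so after shifting e by 2 its last term drops out.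
    δ⁽suc⁾[e+2]≡sumBelow-tail : δ⁽ suc b ⁾ (e + 2) M ≡ sumBelow N tail
    δ⁽suc⁾[e+2]≡sumBelow-tail = begin
      δ⁽ suc b ⁾ (e + 2) M              ≡⟨ sumℤ-map-upTo tail (suc N) ⟩
      sumBelow (suc N) tail              ≡⟨ sumBelow-suc N tail ⟩
      sumBelow N tail ℤ.+ tail N         ≡⟨ cong (ℤ._+_ (sumBelow N tail)) (δ⁽⁾-vanishes b _ N<e+2+2N) ⟩
      sumBelow N tail ℤ.+ 0ℤ             ≡⟨ ℤP.+-identityʳ _ ⟩
      sumBelow N tail                    ∎

  δ⁽⁾≡weightedSum : ∀ b s e → Σ M ≡ 2 * s + e → δ⁽ b ⁾ e M ≡ weightedSum b s signedα
  δ⁽⁾≡weightedSum zero s e Σ≡2s+e =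
    trans (δ≡sumBelow-signedα s e Σ≡2s+e) (sym (weightedSum-zero s signedα))
  δ⁽⁾≡weightedSum (suc b) zero e Σ≡e = begin
    δ⁽ suc b ⁾ e M
      ≡⟨ δ⁽suc⁾-step b e ⟩
    δ⁽ b ⁾ e M ℤ.+ δ⁽ suc b ⁾ (e + 2) M
      ≡⟨ cong₂ ℤ._+_ (δ⁽⁾≡weightedSum b zero e Σ≡e)
                     (δ⁽⁾-vanishes (suc b) (e + 2) (subst (_< e + 2) (sym Σ≡e) (m<m+n e z<s))) ⟩
    weightedSum b 0 signedα ℤ.+ 0ℤ
      ≡⟨ ℤP.+-identityʳ _ ⟩
    weightedSum b 0 signedα
      ≡⟨ trans (weightedSum-at-0 b signedα) (sym (weightedSum-at-0 (suc b) signedα)) ⟩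
    weightedSum (suc b) 0 signedα ∎
    where open ≡-Reasoning
  δ⁽⁾≡weightedSum (suc b) (suc s) e Σ≡2s+e = begin
    δ⁽ suc b ⁾ e M
      ≡⟨ δ⁽suc⁾-step b e ⟩
    δ⁽ b ⁾ e M ℤ.+ δ⁽ suc b ⁾ (e + 2) M
      ≡⟨ cong₂ ℤ._+_ (δ⁽⁾≡weightedSum b (suc s) e Σ≡2s+e)
                     (δ⁽⁾≡weightedSum (suc b) s (e + 2) (trans Σ≡2s+e (2[1+s]+e≡2s+[e+2] s e))) ⟩
    weightedSum b (suc s) signedα ℤ.+ weightedSum (suc b) s signedα
      ≡⟨ sym (weightedSum-pascal b s signedα) ⟩
    weightedSum (suc b) (suc s) signedα ∎
    where
    open ≡-Reasoning
    2[1+s]+e≡2s+[e+2] : ∀ s e → 2 * suc s + e ≡ 2 * s + (e + 2)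
    2[1+s]+e≡2s+[e+2] = ℕSolver.solve-∀

lemma6 : ∀ {n} (M : Position n) (s e b : ℕ) → 1 Data.Nat.≤ e → 1 Data.Nat.≤ b →
    Σ M ≡ 2 * s + e →
    deltaB b e M ≡ sumℤ (map (λ r → ℤ.+ ((s + b ∸ 1 ∸ r) C (b ∸ 1)) ℤ.* (sign r ℤ.* ℤ.+ (α r M))) (upTo (suc s)))
lemma6 M s e (suc b) _ _ Σ≡2s+e = begin
  δ⁽ b ⁾ e M
    ≡⟨ δ⁽⁾≡weightedSum M b s e Σ≡2s+e ⟩
  weightedSum b s (signedα M)
    ≡⟨ sumBelow-cong (suc s) (λ {r} r<1+s → cong (λ k → ℤ.+ (k C b) ℤ.* signedα M r)
         (sym (reindex (s≤s⁻¹ r<1+s)))) ⟩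
  sumBelow (suc s) term
    ≡⟨ sym (sumℤ-map-upTo term (suc s)) ⟩
  sumℤ (map term (upTo (suc s))) ∎
  where
  open ≡-Reasoning
  term : ℕ → ℤ
  term r = ℤ.+ ((s + suc b ∸ 1 ∸ r) C b) ℤ.* signedα M r
  reindex : ∀ {r} → r ≤ s → s + suc b ∸ 1 ∸ r ≡ s ∸ r + b
  reindex {r} r≤s = trans (cong (λ x → x ∸ 1 ∸ r) (+-suc s b)) (+-∸-comm b r≤s)
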